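{- Let $\mathcal{A}$ be a complementary alphabet with $m\ge1$ complementary pairs. For every plane tree $T$ with $n\ge1$ edges there exists a word $P$ of length $2n$ in $\mathcal{A}$ such that $T$ is $P$-valid and $T$ is the tree $T_0(P)$ produced by the greedy algorithm on $P$.
   Context: A complementary alphabet with $m$ complementary pairs is a set of $2m$ letters in which every letter $B$ has a unique complement $\overline{B}\neq B$ with $\overline{\overline{B}}=B$. A plane tree is a rooted tree with linearly ordered children at each vertex. For a plane tree with $n$ edges, the $2n$ half-edges are labeled $1,\dots,2n$ by starting on the left side of the leftmost root edge and walking counterclockwise; each edge is $e(i,j)$, $i<j$, with $i,j$ the labels of its sides. For $P=p_1\cdots p_{2n}$, a plane tree with $n$ edges is $P$-valid if $p_i,p_j$ are complements for every edge $e(i,j)$. Greedy algorithm on $P$: process positions $i=1,\dots,2n$ in order; at $i$, let $j_i<i$ be the largest currently unmatched position; if $p_i,p_{j_i}$ are complements, match them (edge $e(j_i,i)$), otherwise leave $i$ unmatched. When some $P$-valid tree exists, the output is a $P$-valid plane tree, denoted $T_0(P)$. -}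

module Defs where

open import Data.Nat using (ℕ; zero; suc; _+_; _*_)
open import Data.Fin using (Fin)
open import Data.List using (List; []; _∷_; _++_)
open import Data.Product using (Σ; _×_; _,_; proj₁)
open import Data.Maybe using (Maybe; just; nothing)
open import Relation.Binary.PropositionalEquality using (_≡_; _≢_)
open import Relation.Nullary using (Dec; yes; no)
open import Relation.Binary.Definitions using (DecidableEquality)
open import Function.Bundles using (_↔_)

record ComplementaryAlphabet (m : ℕ) : Set₁ where
  field
    Letter     : Set
    card       : Fin (2 * m) ↔ Letter
    _≟_        : DecidableEquality Letter   -- derivable from card; included for computability
    comp       : Letter → Letter
    comp-inv   : ∀ b → comp (comp b) ≡ b
    comp-nofix : ∀ b → comp b ≢ b

data PTree : Set where
  node : List PTree → PTree

mutual
  edgeCount : PTree → ℕ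
  edgeCount (node cs) = edgeCountF cs

  edgeCountF : List PTree → ℕ
  edgeCountF []        = 0
  edgeCountF (t ∷ ts)  = suc (edgeCount t + edgeCountF ts)

-- Half-edge labelling by the counterclockwise contour walk.
-- edgesF ts k : edges of the forest ts (hanging from a common parent) whose
-- first half-edge gets label k; returns edges e(i,j) as pairs (i , j), i < j,
-- together with the next unused label.
edgesF : List PTree → ℕ → List (ℕ × ℕ) × ℕ
edgesF []               k = [] , k
edgesF (node cs ∷ ts)   k with edgesF cs (suc k)
... | es₁ , k₁ with edgesF ts (suc k₁)
...   | es₂ , k₂ = (es₁ ++ ((k , k₁) ∷ es₂)) , k₂

edges : PTree → List (ℕ × ℕ)
edges (node cs) = proj₁ (edgesF cs 1)

module _ {m : ℕ} (𝒜 : ComplementaryAlphabet m) where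
  open ComplementaryAlphabet 𝒜

  -- letter at (1-based) position i of a word
  at : List Letter → ℕ → Maybe Letter
  at []       _             = nothing
  at (x ∷ xs) zero          = nothing
  at (x ∷ xs) (suc zero)    = just x
  at (x ∷ xs) (suc (suc i)) = at xs (suc i)

  Complements : List Letter → ℕ → ℕ → Set
  Complements P i j = Σ Letter λ a → Σ Letter λ b →
    (at P i ≡ just a) × (at P j ≡ just b) × (b ≡ comp a)

  Valid : List Letter → PTree → Set
  Valid P T = ∀ i j → (i , j) ∈ edges T → Complements P i j
    where open import Data.List.Membership.Propositional using (_∈_)

  -- Greedy algorithm: the stack holds unmatched positions (with letters),
  -- the top being the largest unmatched position.
  greedyGo : List Letter → ℕ → List (ℕ × Letter) → List (ℕ × ℕ)
  greedyGo []       i st = []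
  greedyGo (x ∷ xs) i [] = greedyGo xs (suc i) ((i , x) ∷ [])
  greedyGo (x ∷ xs) i ((j , y) ∷ st) with x ≟ comp y
  ... | yes _ = (j , i) ∷ greedyGo xs (suc i) st
  ... | no  _ = greedyGo xs (suc i) ((i , x) ∷ (j , y) ∷ st)

  greedy : List Letter → List (ℕ × ℕ)
  greedy P = greedyGo P 1 []

-- Fix a letter a.  Write a on the left side and its complement ā on the right
-- side of every edge, so the contour word of T reads a when the walk goes down
-- an edge and ā when it comes back up.  On such a word the greedy stack only
-- ever holds a's: each a is pushed (a ≠ ā), and each ā pops exactly the position
-- where the walk went down the same edge.  Hence the greedy output is the edge
-- list of T, and T is valid because every pair the greedy algorithm matches is
-- complementary.
module Submission where

open import Defs
open import Data.Nat using (ℕ; _*_; _≤_; suc; _+_)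
open import Data.Nat.Properties using (+-comm)
open import Data.Nat.Solver using (module +-*-Solver)
open import Data.List using (List; length; []; _∷_; _++_; _∷ʳ_)
open import Data.List.Properties using (++-assoc; ∷ʳ-++; length-++; ++-identityʳ)
open import Data.List.Relation.Unary.All using (All; []; _∷_)
open import Data.List.Relation.Unary.Any using (here; there)
open import Data.List.Membership.Propositional using (_∈_)
open import Data.Product using (Σ; _×_; _,_; proj₁; proj₂)
open import Data.Maybe using (just)
open import Data.Fin using (Fin)
open import Data.Empty using (⊥-elim)
open import Relation.Binary.PropositionalEquality
  using (_≡_; refl; sym; trans; cong; cong₂; subst; module ≡-Reasoning)
open import Relation.Nullary using (yes; no)
open import Function.Bundles using (_⇔_; mk⇔; Inverse)

module _ {m : ℕ} (𝒜 : ComplementaryAlphabet m) where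
  open ComplementaryAlphabet 𝒜

  at-++-∷ : ∀ pre (x : Letter) xs → at 𝒜 (pre ++ x ∷ xs) (suc (length pre)) ≡ just x
  at-++-∷ []            x xs = refl
  at-++-∷ (_ ∷ [])      x xs = refl
  at-++-∷ (_ ∷ q ∷ pre) x xs = at-++-∷ (q ∷ pre) x xs

  record SuffixAt (P : List Letter) (i : ℕ) (xs : List Letter) : Set where
    field
      prefix   : List Letter
      splits   : prefix ++ xs ≡ P
      position : suc (length prefix) ≡ i

  suffixAt-head : ∀ {P i x xs} → SuffixAt P i (x ∷ xs) → at 𝒜 P i ≡ just x
  suffixAt-head {x = x} {xs} record { prefix = pre ; splits = refl ; position = refl } =
    at-++-∷ pre x xs

  suffixAt-tail : ∀ {P i x xs} → SuffixAt P i (x ∷ xs) → SuffixAt P (suc i) xs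
  suffixAt-tail {x = x} {xs} record { prefix = pre ; splits = refl ; position = refl } = record
    { prefix   = pre ∷ʳ x
    ; splits   = ∷ʳ-++ pre x xs
    ; position = cong suc (trans (length-++ pre) (+-comm (length pre) 1))
    }

  Stacked : List Letter → ℕ × Letter → Set
  Stacked P (j , y) = at 𝒜 P j ≡ just y

  greedyGo-sound : ∀ {P i} xs st → SuffixAt P i xs → All (Stacked P) st →
                   ∀ {j k} → (j , k) ∈ greedyGo 𝒜 xs i st → Complements 𝒜 P j k
  greedyGo-sound []       st            s stacked ()
  greedyGo-sound (x ∷ xs) []            s stacked mem =
    greedyGo-sound xs _ (suffixAt-tail s) (suffixAt-head s ∷ []) mem
  greedyGo-sound (x ∷ xs) ((_ , y) ∷ st) s (yAt ∷ stacked) mem with x ≟ comp y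
  ... | no _ = greedyGo-sound xs _ (suffixAt-tail s) (suffixAt-head s ∷ yAt ∷ stacked) mem
  ... | yes x≡ȳ with mem
  ...   | here refl  = y , x , yAt , suffixAt-head s , x≡ȳ
  ...   | there mem′ = greedyGo-sound xs st (suffixAt-tail s) stacked mem′

  greedy-sound : ∀ P {j k} → (j , k) ∈ greedy 𝒜 P → Complements 𝒜 P j k
  greedy-sound P = greedyGo-sound P [] (record { prefix = [] ; splits = refl ; position = refl }) []

  greedyGo-push : ∀ a xs k st → All (λ e → proj₂ e ≡ a) st →
                  greedyGo 𝒜 (a ∷ xs) k st ≡ greedyGo 𝒜 xs (suc k) ((k , a) ∷ st)
  greedyGo-push a xs k []            _ = refl
  greedyGo-push a xs k ((_ , _) ∷ st) (refl ∷ _) with a ≟ comp a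
  ... | yes a≡ā = ⊥-elim (comp-nofix a (sym a≡ā))
  ... | no  _   = refl

  greedyGo-pop : ∀ a xs k j st →
                 greedyGo 𝒜 (comp a ∷ xs) k ((j , a) ∷ st) ≡ (j , k) ∷ greedyGo 𝒜 xs (suc k) st
  greedyGo-pop a xs k j st with comp a ≟ comp a
  ... | yes _ = refl
  ... | no ā≢ā = ⊥-elim (ā≢ā refl)

edgesF-∷ : ∀ cs ts k → edgesF (node cs ∷ ts) k ≡
  ( proj₁ (edgesF cs (suc k))
      ++ (k , proj₂ (edgesF cs (suc k))) ∷ proj₁ (edgesF ts (suc (proj₂ (edgesF cs (suc k)))))
  , proj₂ (edgesF ts (suc (proj₂ (edgesF cs (suc k))))) )
edgesF-∷ cs ts k with edgesF cs (suc k)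
... | _ , k₁ with edgesF ts (suc k₁)
...   | _ = refl

module ContourWord {m : ℕ} (𝒜 : ComplementaryAlphabet m)
                   (a : ComplementaryAlphabet.Letter 𝒜) where
  open ComplementaryAlphabet 𝒜

  contourWordF : List PTree → List Letter
  contourWordF []             = []
  contourWordF (node cs ∷ ts) = a ∷ (contourWordF cs ++ comp a ∷ contourWordF ts)

  length-contourWordF : ∀ ts → length (contourWordF ts) ≡ 2 * edgeCountF ts
  length-contourWordF []             = refl
  length-contourWordF (node cs ∷ ts) = begin
    suc (length (contourWordF cs ++ comp a ∷ contourWordF ts))
      ≡⟨ cong suc (length-++ (contourWordF cs)) ⟩
    suc (length (contourWordF cs) + suc (length (contourWordF ts)))
      ≡⟨ cong₂ (λ u v → suc (u + suc v)) (length-contourWordF cs) (length-contourWordF ts) ⟩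
    suc (2 * edgeCountF cs + suc (2 * edgeCountF ts))
      ≡⟨ solve 2 (λ x y → con 1 :+ (con 2 :* x :+ (con 1 :+ con 2 :* y))
                          := con 2 :* (con 1 :+ (x :+ y))) refl (edgeCountF cs) (edgeCountF ts) ⟩
    2 * suc (edgeCountF cs + edgeCountF ts) ∎
    where open ≡-Reasoning
          open +-*-Solver

  greedyGo-contourWordF : ∀ ts k st xs → All (λ e → proj₂ e ≡ a) st →
    greedyGo 𝒜 (contourWordF ts ++ xs) k st
      ≡ proj₁ (edgesF ts k) ++ greedyGo 𝒜 xs (proj₂ (edgesF ts k)) st
  greedyGo-contourWordF []             k st xs onlyA = refl
  greedyGo-contourWordF (node cs ∷ ts) k st xs onlyA = begin
    greedyGo 𝒜 (a ∷ (contourWordF cs ++ comp a ∷ contourWordF ts) ++ xs) k st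
      ≡⟨ greedyGo-push 𝒜 a _ k st onlyA ⟩
    greedyGo 𝒜 ((contourWordF cs ++ comp a ∷ contourWordF ts) ++ xs) (suc k) ((k , a) ∷ st)
      ≡⟨ cong (λ w → greedyGo 𝒜 w (suc k) ((k , a) ∷ st)) (++-assoc (contourWordF cs) _ xs) ⟩
    greedyGo 𝒜 (contourWordF cs ++ comp a ∷ (contourWordF ts ++ xs)) (suc k) ((k , a) ∷ st)
      ≡⟨ greedyGo-contourWordF cs (suc k) _ _ (refl ∷ onlyA) ⟩
    es₁ ++ greedyGo 𝒜 (comp a ∷ (contourWordF ts ++ xs)) k₁ ((k , a) ∷ st)
      ≡⟨ cong (es₁ ++_) (greedyGo-pop 𝒜 a _ k₁ k st) ⟩
    es₁ ++ (k , k₁) ∷ greedyGo 𝒜 (contourWordF ts ++ xs) (suc k₁) st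
      ≡⟨ cong (λ w → es₁ ++ (k , k₁) ∷ w) (greedyGo-contourWordF ts (suc k₁) st xs onlyA) ⟩
    es₁ ++ (k , k₁) ∷ (es₂ ++ greedyGo 𝒜 xs k₂ st)
      ≡⟨ sym (++-assoc es₁ ((k , k₁) ∷ es₂) _) ⟩
    (es₁ ++ (k , k₁) ∷ es₂) ++ greedyGo 𝒜 xs k₂ st
      ≡⟨ cong (λ e → proj₁ e ++ greedyGo 𝒜 xs (proj₂ e) st) (sym (edgesF-∷ cs ts k)) ⟩
    proj₁ (edgesF (node cs ∷ ts) k) ++ greedyGo 𝒜 xs (proj₂ (edgesF (node cs ∷ ts) k)) st ∎
    where
    open ≡-Reasoning
    es₁ es₂ : List (ℕ × ℕ)
    k₁ k₂ : ℕ
    es₁ = proj₁ (edgesF cs (suc k))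
    k₁  = proj₂ (edgesF cs (suc k))
    es₂ = proj₁ (edgesF ts (suc k₁))
    k₂  = proj₂ (edgesF ts (suc k₁))

  greedy-contourWord : ∀ cs → greedy 𝒜 (contourWordF cs) ≡ edges (node cs)
  greedy-contourWord cs = begin
    greedyGo 𝒜 (contourWordF cs) 1 []
      ≡⟨ cong (λ w → greedyGo 𝒜 w 1 []) (sym (++-identityʳ (contourWordF cs))) ⟩
    greedyGo 𝒜 (contourWordF cs ++ []) 1 []
      ≡⟨ greedyGo-contourWordF cs 1 [] [] [] ⟩
    edges (node cs) ++ []
      ≡⟨ ++-identityʳ _ ⟩
    edges (node cs) ∎
    where open ≡-Reasoning

mainTheorem14 : (m : ℕ) → 1 ≤ m → (𝒜 : ComplementaryAlphabet m) →
    (n : ℕ) → 1 ≤ n → (T : PTree) → edgeCount T ≡ n →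
    Σ (List (ComplementaryAlphabet.Letter 𝒜)) λ P →
    (length P ≡ 2 * n) × Valid 𝒜 P T
    × (∀ i j → ((i , j) ∈ greedy 𝒜 P) ⇔ ((i , j) ∈ edges T))
mainTheorem14 (suc _) _ 𝒜 _ _ (node cs) refl =
  P , length-contourWordF cs , valid , λ i j → mk⇔ (subst (_ ∈_) P-greedy) (subst (_ ∈_) (sym P-greedy))
  where
  open ContourWord 𝒜 (Inverse.to (ComplementaryAlphabet.card 𝒜) Fin.zero)
  P : List (ComplementaryAlphabet.Letter 𝒜)
  P = contourWordF cs
  P-greedy : greedy 𝒜 P ≡ edges (node cs)
  P-greedy = greedy-contourWord cs
  valid : Valid 𝒜 P (node cs)
  valid i j e∈T = greedy-sound 𝒜 P (subst (_ ∈_) (sym P-greedy) e∈T)
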